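{- Let $n$ be a positive integer and let $u$ be a column with all entries in $\{1,\dots,n\}$, and put $k=n-\ell(u)$, assumed $\ge 1$. Let $\zeta=\mathfrak p(u,n)+1^k=[\widetilde u_1,\widetilde u_2-1,\dots,\widetilde u_k-k+1]\in\mathbb N^k$. Then the map $v\mapsto \mu=\mathfrak p(v,n)$ is a bijection from the set of columns $v$ with entries in $\{1,\dots,n\}$ such that $(v,u)$ is a staircase, onto the set of weakly increasing sequences $\mu\in\mathbb N^{k-1}$ such that $\mu\subseteq\zeta$ and $\zeta/\mu$ is a ribbon.
   Context: A column is a strictly decreasing finite sequence $u=[u_1>u_2>\dots>u_m]$ of positive integers; $\ell(u)=m$ is its length (the empty column has length $0$). Two columns $(v,u)$ form a staircase if $\ell(v)=\ell(u)+1$ and $v_{j+1}\le u_j\le v_j$ for all $1\le j\le \ell(u)$ (equivalently: written bottom-aligned as a tableau, rows weakly increase and diagonals weakly decrease). For a column $w$ with entries in $\{1,\dots,n\}$, $\widetilde w$ denotes the complement of $w$ in $\{1,\dots,n\}$ sorted increasingly, and $\mathfrak p(w,n):=[\widetilde w_1-1,\widetilde w_2-2,\dots,\widetilde w_m-m]$ where $m=n-\ell(w)$ (a weakly increasing sequence). Partitions are written as weakly increasing sequences $\lambda=(\lambda_1\le\dots\le\lambda_m)$; the diagram of $\lambda$ is the set of boxes $(i,j)$ with $1\le i\le m$, $1\le j\le\lambda_i$ (row $i$ drawn above row $i+1$). A sequence $\mu\in\mathbb N^{k-1}$ is compared with $\zeta\in\mathbb N^k$ by identifying it with $(0,\mu_1,\dots,\mu_{k-1})$;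 $\mu\subseteq\zeta$ means the diagram of $(0,\mu_1,\dots,\mu_{k-1})$ is contained in that of $\zeta$, and $\zeta/\mu$ is the set-difference of the diagrams. Such a skew diagram is a ribbon if it contains no $2\times2$ square $\{(i,j),(i,j+1),(i+1,j),(i+1,j+1)\}$ (ribbons need not be connected). -}

module Defs where

open import Data.Nat using (ℕ; zero; suc; _∸_; _≤_; _<_; _>_; _≡ᵇ_)
open import Data.Bool using (Bool; not)
open import Data.List using (List; []; _∷_; length; map; filter; upTo)
open import Data.Bool.ListAction using (any)
open import Data.Maybe using (Maybe; just; nothing)
open import Data.Product using (Σ; _×_; ∃)
open import Data.List.Relation.Unary.All using (All)
open import Data.List.Relation.Unary.Linked using (Linked)
open import Relation.Binary.PropositionalEquality using (_≡_)
open import Relation.Nullary using (¬_)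
open import Data.Bool using (T)
open import Relation.Nullary.Decidable using (does)

_‼_ : {A : Set} → List A → ℕ → Maybe A
[]       ‼ _       = nothing
(x ∷ xs) ‼ zero    = just x
(x ∷ xs) ‼ (suc i) = xs ‼ i

IsColumn : List ℕ → Set
IsColumn u = Linked _>_ u × All (λ x → 1 ≤ x) u

EntriesIn : ℕ → List ℕ → Set
EntriesIn n u = All (λ x → 1 ≤ x × x ≤ n) u

-- (v,u) is a staircase: ℓ(v) = ℓ(u)+1 and v_{j+1} ≤ u_j ≤ v_j (0-indexed here)
Staircase : List ℕ → List ℕ → Set
Staircase v u = length v ≡ suc (length u) ×
  (∀ (j a b c : ℕ) → v ‼ suc j ≡ just a → u ‼ j ≡ just b → v ‼ j ≡ just c →
     a ≤ b × b ≤ c)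

elem : ℕ → List ℕ → Bool
elem i w = any (λ x → i ≡ᵇ x) w

compl : ℕ → List ℕ → List ℕ
compl n w = filter (λ i → T? (not (elem i w))) (map suc (upTo n))
  where
    open import Data.Bool.Properties using () renaming (T? to T?)

shiftDown : ℕ → List ℕ → List ℕ
shiftDown i []       = []
shiftDown i (x ∷ xs) = (x ∸ i) ∷ shiftDown (suc i) xs

𝔭 : List ℕ → ℕ → List ℕ
𝔭 w n = shiftDown 1 (compl n w)

-- diagram of a sequence λ: box (i,j) (row i 0-indexed, column j ≥ 1) with j ≤ λ_i
InDiag : List ℕ → ℕ → ℕ → Set
InDiag lam i j = Σ ℕ (λ a → lam ‼ i ≡ just a × 1 ≤ j × j ≤ a)

-- μ ∈ ℕ^{k-1} compared with ζ ∈ ℕ^k via (0, μ_1, …)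
pad : List ℕ → List ℕ
pad μ = 0 ∷ μ

Contained : List ℕ → List ℕ → Set
Contained μ ζ = ∀ i j → InDiag (pad μ) i j → InDiag ζ i j

InSkew : List ℕ → List ℕ → ℕ → ℕ → Set
InSkew ζ μ i j = InDiag ζ i j × ¬ InDiag (pad μ) i j

IsRibbon : List ℕ → List ℕ → Set
IsRibbon ζ μ = ∀ i j → ¬ (InSkew ζ μ i j × InSkew ζ μ i (suc j) ×
                          InSkew ζ μ (suc i) j × InSkew ζ μ (suc i) (suc j))

WeaklyIncr : List ℕ → Set
WeaklyIncr = Linked _≤_

Source : ℕ → List ℕ → List ℕ → Set
Source n u v = IsColumn v × EntriesIn n v × Staircase v u

Target : ℕ → List ℕ → List ℕ → Set
Target n u μ = length μ ≡ (n ∸ length u) ∸ 1 × WeaklyIncr μ ×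
  Contained μ (map suc (𝔭 u n)) × IsRibbon (map suc (𝔭 u n)) μ

{-# OPTIONS --safe #-}

-- Reading downwards from n, (v,u) is a staircase iff n ≥ v₁ ≥ u₁ ≥ v₂ ≥ … ≥ v_ℓ(v), and
-- taking complements in {1,…,n} turns such a zigzag into one for the complements, with the
-- roles of the two columns exchanged. Hence, with U = ũ and V = ṽ listed increasingly, (v,u)
-- is a staircase iff U₁ ≤ V₁ ≤ U₂ ≤ … ≤ V_{k-1} ≤ U_k. For ζ_i = U_i − i + 1 and
-- μ_i = V_i − i, the inequality V_i ≤ U_{i+1} says that row i+1 of (0,μ) fits into ζ, and
-- U_i ≤ V_i says ζ_i ≤ μ_i + 1, i.e. that rows i and i+1 of ζ/μ contain no 2×2 square.
-- Complementing and shifting are invertible, so v ↦ 𝔭(v,n) is a bijection.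

module Submission where

open import Defs
open import Data.Nat
  using (ℕ; zero; suc; pred; _+_; _∸_; _≤_; _<_; _>_; _≡ᵇ_; z≤n; s≤s; _≤?_; >-nonZero)
open import Data.Nat.Properties
open import Data.Bool using (true; false; not; T)
open import Data.Bool.Properties using (T?)
open import Data.Unit using (⊤; tt)
open import Data.Empty using (⊥; ⊥-elim)
open import Data.List
  using (List; []; _∷_; length; map; filter; upTo; applyUpTo; applyDownFrom; reverse; reverseAcc; _++_; [_])
open import Data.List.Properties
  using ( map-upTo; reverse-applyDownFrom; unfold-reverse; filter-++; ++-identityʳ; length-map
        ; length-reverse; reverse-involutive; reverse-injective)
open import Data.List.Relation.Unary.All as All using (All; []; _∷_)
import Data.List.Relation.Unary.All.Properties as All
import Data.List.Relation.Unary.Any.Properties as Any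
open import Data.List.Relation.Unary.AllPairs using (_∷_)
open import Data.List.Relation.Unary.Linked as Linked using (Linked; []; [-]; _∷_)
import Data.List.Relation.Unary.Linked.Properties as Linked
open import Data.Maybe using (Maybe; just)
import Data.Maybe as Maybe
open import Data.Maybe.Properties using (map-just)
open import Data.Product using (Σ; ∃; ∃₂; _×_; _,_; proj₁; proj₂; swap)
open import Data.Sum using (inj₁; inj₂)
open import Function using (_∘_; flip)
open import Relation.Binary.PropositionalEquality hiding ([_])
open import Relation.Nullary using (¬_; does; yes; no)
open import Relation.Nullary.Decidable using (dec-true; dec-false)
open import Relation.Unary using (Pred; Decidable)

private variable
  A B : Set
  n m j k a z : ℕ
  u v w xs ys U V μ ζ : List ℕ

‼⇒< : ∀ (xs : List A) i {a} → xs ‼ i ≡ just a → i < length xs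
‼⇒< []       _       ()
‼⇒< (_ ∷ _)  zero    _ = s≤s z≤n
‼⇒< (_ ∷ xs) (suc i) e = s≤s (‼⇒< xs i e)

<⇒‼ : ∀ (xs : List A) i → i < length xs → ∃ λ a → xs ‼ i ≡ just a
<⇒‼ (x ∷ xs) zero    _         = x , refl
<⇒‼ (x ∷ xs) (suc i) (s≤s i<n) = <⇒‼ xs i i<n

All-‼ : ∀ {P : A → Set} {xs : List A} {a} i → All P xs → xs ‼ i ≡ just a → P a
All-‼ zero    (p ∷ _)  refl = p
All-‼ (suc i) (_ ∷ ps) e    = All-‼ i ps e

‼-All : ∀ {P : A → Set} (xs : List A) → (∀ i {a} → xs ‼ i ≡ just a → P a) → All P xs
‼-All []       _ = []
‼-All (x ∷ xs) p = p zero refl ∷ ‼-All xs (λ i → p (suc i))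

Linked-‼ : ∀ {R : A → A → Set} {xs : List A} {a c} i →
           Linked R xs → xs ‼ i ≡ just a → xs ‼ suc i ≡ just c → R a c
Linked-‼ zero    (r ∷ _) refl refl = r
Linked-‼ (suc i) (_ ∷ l) ea   ec   = Linked-‼ i l ea ec

‼-++ˡ : ∀ (xs ys : List A) {i} → i < length xs → (xs ++ ys) ‼ i ≡ xs ‼ i
‼-++ˡ (x ∷ xs) ys {zero}  _         = refl
‼-++ˡ (x ∷ xs) ys {suc i} (s≤s i<n) = ‼-++ˡ xs ys i<n

‼-++-length : ∀ (xs : List A) {y ys} → (xs ++ y ∷ ys) ‼ length xs ≡ just y
‼-++-length []       = refl
‼-++-length (x ∷ xs) = ‼-++-length xs

reverse-‼ : ∀ (xs : List A) {i} → i < length xs → reverse xs ‼ i ≡ xs ‼ (length xs ∸ suc i)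
reverse-‼ (x ∷ xs) {i} i<1+n rewrite unfold-reverse x xs with m≤n⇒m<n∨m≡n (≤-pred i<1+n)
... | inj₁ i<n = begin
  (reverse xs ++ [ x ]) ‼ i  ≡⟨ ‼-++ˡ (reverse xs) [ x ] (subst (i <_) (sym (length-reverse xs)) i<n) ⟩
  reverse xs ‼ i             ≡⟨ reverse-‼ xs i<n ⟩
  xs ‼ (length xs ∸ suc i)   ≡⟨ cong ((x ∷ xs) ‼_) (+-∸-assoc 1 i<n) ⟨
  (x ∷ xs) ‼ (length xs ∸ i) ∎
  where open ≡-Reasoning
... | inj₂ refl = begin
  (reverse xs ++ [ x ]) ‼ length xs           ≡⟨ cong ((reverse xs ++ [ x ]) ‼_) (length-reverse xs) ⟨
  (reverse xs ++ [ x ]) ‼ length (reverse xs) ≡⟨ ‼-++-length (reverse xs) ⟩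
  just x                                      ≡⟨ cong ((x ∷ xs) ‼_) (n∸n≡0 (length xs)) ⟨
  (x ∷ xs) ‼ (length xs ∸ length xs)          ∎
  where open ≡-Reasoning

map-‼ : ∀ (f : A → B) (xs : List A) i → map f xs ‼ i ≡ Maybe.map f (xs ‼ i)
map-‼ f []       _       = refl
map-‼ f (x ∷ xs) zero    = refl
map-‼ f (x ∷ xs) (suc i) = map-‼ f xs i

map-just⁻¹ : ∀ {f : A → B} (ma : Maybe A) {b} → Maybe.map f ma ≡ just b →
             ∃ λ a → ma ≡ just a × f a ≡ b
map-just⁻¹ (just a) refl = a , refl , refl

Linked-reverse : ∀ {R : A → A → Set} {xs : List A} → Linked R xs → Linked (flip R) (reverse xs)
Linked-reverse []        = []
Linked-reverse [-]       = [-]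
Linked-reverse {R = R} (r ∷ l) = onto (r ∷ [-]) l
  where
    onto : ∀ {y ys acc} → Linked (flip R) (y ∷ acc) → Linked R (y ∷ ys) →
           Linked (flip R) (reverseAcc (y ∷ acc) ys)
    onto acc [-]     = acc
    onto acc (r ∷ l) = onto (r ∷ acc) l

All-reverse : ∀ {P : A → Set} {xs : List A} → All P xs → All P (reverse xs)
All-reverse ps = All.tabulate (λ x∈ → All.lookup ps (Any.reverse⁻ x∈))

filter-reverse : ∀ {ℓ} {P : Pred A ℓ} (P? : Decidable P) xs →
                 filter P? (reverse xs) ≡ reverse (filter P? xs)
filter-reverse P? []       = refl
filter-reverse P? (x ∷ xs) = begin
  filter P? (reverse (x ∷ xs))               ≡⟨ cong (filter P?) (unfold-reverse x xs) ⟩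
  filter P? (reverse xs ++ [ x ])            ≡⟨ filter-++ P? (reverse xs) [ x ] ⟩
  filter P? (reverse xs) ++ filter P? [ x ]  ≡⟨ cong (_++ filter P? [ x ]) (filter-reverse P? xs) ⟩
  reverse (filter P? xs) ++ filter P? [ x ]  ≡⟨ snoc ⟩
  reverse (filter P? (x ∷ xs))               ∎
  where
    open ≡-Reasoning
    snoc : reverse (filter P? xs) ++ filter P? [ x ] ≡ reverse (filter P? (x ∷ xs))
    snoc with does (P? x)
    ... | true  = sym (unfold-reverse x (filter P? xs))
    ... | false = ++-identityʳ _

-- Complements of columns

ColumnIn : ℕ → List ℕ → Set
ColumnIn n w = Linked _>_ w × EntriesIn n w

ColumnIn⇒≤ : ColumnIn n w → All (_≤ n) w
ColumnIn⇒≤ (_ , entries) = All.map proj₂ entries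

ColumnIn-zero : ColumnIn 0 w → w ≡ []
ColumnIn-zero {w = []} _ = refl
ColumnIn-zero {w = _ ∷ _} (_ , (s≤s _ , ()) ∷ _)

data TopView (n : ℕ) : List ℕ → Set where
  top   : ∀ {w} → ColumnIn n w → TopView n (suc n ∷ w)
  below : ∀ {w} → ColumnIn n w → TopView n w

below-head : ∀ {x} → Linked _>_ (x ∷ w) → All (_< x) w
below-head x>w with Linked.Linked⇒AllPairs (flip <-trans) x>w
... | x>w′ ∷ _ = x>w′

ColumnIn-tail : ∀ {x} → ColumnIn m (x ∷ w) → x ≤ suc n → ColumnIn n w
ColumnIn-tail (x>w , _ ∷ w∈) x≤1+n =
  Linked.tail x>w ,
  All.zipWith (λ { ((1≤y , _) , y<x) → 1≤y , ≤-pred (≤-trans y<x x≤1+n) }) (w∈ , below-head x>w)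

topView : ColumnIn (suc n) w → TopView n w
topView {w = []} _ = below ([] , [])
topView {w = x ∷ w} c@(x>w , (1≤x , x≤1+n) ∷ _) with m≤n⇒m<n∨m≡n x≤1+n
... | inj₁ (s≤s x≤n) = below (x>w , (1≤x , x≤n) ∷ proj₂ (ColumnIn-tail c (m≤n⇒m≤1+n x≤n)))
... | inj₂ refl      = top (ColumnIn-tail c ≤-refl)

≡ᵇ-refl : ∀ n → (n ≡ᵇ n) ≡ true
≡ᵇ-refl n = dec-true (n ≟ n) refl

≢⇒≡ᵇ≡false : m ≢ n → (m ≡ᵇ n) ≡ false
≢⇒≡ᵇ≡false {m} {n} m≢n = dec-false (m ≟ n) m≢n

elem-head : ∀ x w → elem x (x ∷ w) ≡ true
elem-head x w rewrite ≡ᵇ-refl x = refl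

elem-above : All (_< n) w → elem n w ≡ false
elem-above []                         = refl
elem-above {n} {y ∷ _} (y<n ∷ w<n) rewrite ≢⇒≡ᵇ≡false (>⇒≢ y<n) = elem-above w<n

notElem? : ∀ w → Decidable (λ i → T (not (elem i w)))
notElem? w i = T? (not (elem i w))

compl↓ : ℕ → List ℕ → List ℕ
compl↓ n w = filter (notElem? w) (applyDownFrom suc n)

compl-reverse : ∀ n w → compl n w ≡ reverse (compl↓ n w)
compl-reverse n w = begin
  filter (notElem? w) (map suc (upTo n))               ≡⟨ cong (filter (notElem? w)) (map-upTo suc n) ⟩
  filter (notElem? w) (applyUpTo suc n)                ≡⟨ cong (filter (notElem? w)) (reverse-applyDownFrom suc n) ⟨
  filter (notElem? w) (reverse (applyDownFrom suc n))  ≡⟨ filter-reverse (notElem? w) (applyDownFrom suc n) ⟩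
  reverse (compl↓ n w)                                 ∎
  where open ≡-Reasoning

compl↓-column : ∀ n w → ColumnIn n (compl↓ n w)
compl↓-column n w =
  Linked.filter⁺ (notElem? w) (flip <-trans) (Linked.applyDownFrom⁺₂ suc n (λ _ → ≤-refl)) ,
  All.filter⁺ (notElem? w) (All.applyDownFrom⁺₁ suc n (λ i<n → s≤s z≤n , i<n))

compl↓-∷ : n < k → compl↓ n (k ∷ w) ≡ compl↓ n w
compl↓-∷ {zero}  _   = refl
compl↓-∷ {suc n} {k} {w} n<k rewrite ≢⇒≡ᵇ≡false (<⇒≢ n<k) with not (elem (suc n) w)
... | true  = cong (suc n ∷_) (compl↓-∷ {w = w} (<-trans (n<1+n n) n<k))
... | false = compl↓-∷ {w = w} (<-trans (n<1+n n) n<k)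

compl↓-top : ∀ n w → compl↓ (suc n) (suc n ∷ w) ≡ compl↓ n w
compl↓-top n w rewrite elem-head (suc n) w = compl↓-∷ {w = w} (n<1+n n)

compl↓-below : ColumnIn n w → compl↓ (suc n) w ≡ suc n ∷ compl↓ n w
compl↓-below c rewrite elem-above (All.map s≤s (ColumnIn⇒≤ c)) = refl

compl↓-involutive : ColumnIn n w → compl↓ n (compl↓ n w) ≡ w
compl↓-involutive {zero} c = sym (ColumnIn-zero c)
compl↓-involutive {suc n} c with topView c
... | top {w} c′ = begin
  compl↓ (suc n) (compl↓ (suc n) (suc n ∷ w))  ≡⟨ cong (compl↓ (suc n)) (compl↓-top n w) ⟩
  compl↓ (suc n) (compl↓ n w)                  ≡⟨ compl↓-below (compl↓-column n w) ⟩
  suc n ∷ compl↓ n (compl↓ n w)                ≡⟨ cong (suc n ∷_) (compl↓-involutive c′) ⟩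
  suc n ∷ w                                    ∎
  where open ≡-Reasoning
... | below {w} c′ = begin
  compl↓ (suc n) (compl↓ (suc n) w)            ≡⟨ cong (compl↓ (suc n)) (compl↓-below c′) ⟩
  compl↓ (suc n) (suc n ∷ compl↓ n w)          ≡⟨ compl↓-top n (compl↓ n w) ⟩
  compl↓ n (compl↓ n w)                        ≡⟨ compl↓-involutive c′ ⟩
  w                                            ∎
  where open ≡-Reasoning

length-compl↓ : ColumnIn n w → length (compl↓ n w) + length w ≡ n
length-compl↓ {zero} c rewrite ColumnIn-zero c = refl
length-compl↓ {suc n} c with topView c
... | top {w} c′ rewrite compl↓-top n w = trans (+-suc _ (length w)) (cong suc (length-compl↓ c′))
... | below c′   rewrite compl↓-below c′ = cong suc (length-compl↓ c′)

length-compl : ColumnIn n w → length (compl n w) ≡ n ∸ length w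
length-compl {n} {w} c = begin
  length (compl n w)                         ≡⟨ cong length (compl-reverse n w) ⟩
  length (reverse (compl↓ n w))              ≡⟨ length-reverse (compl↓ n w) ⟩
  length (compl↓ n w)                        ≡⟨ m+n∸n≡m _ (length w) ⟨
  length (compl↓ n w) + length w ∸ length w  ≡⟨ cong (_∸ length w) (length-compl↓ c) ⟩
  n ∸ length w                               ∎
  where open ≡-Reasoning

compl-increasing : ∀ n w → Linked _<_ (compl n w)
compl-increasing n w = subst (Linked _<_) (sym (compl-reverse n w)) (Linked-reverse (proj₁ (compl↓-column n w)))

compl-entries : ∀ n w → EntriesIn n (compl n w)
compl-entries n w = subst (EntriesIn n) (sym (compl-reverse n w)) (All-reverse (proj₂ (compl↓-column n w)))

compl-injective : ColumnIn n v → ColumnIn n w → compl n v ≡ compl n w → v ≡ w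
compl-injective {n} {v} {w} cv cw eq = begin
  v                      ≡⟨ compl↓-involutive cv ⟨
  compl↓ n (compl↓ n v)  ≡⟨ cong (compl↓ n) compl↓-eq ⟩
  compl↓ n (compl↓ n w)  ≡⟨ compl↓-involutive cw ⟩
  w                      ∎
  where
    open ≡-Reasoning
    compl↓-eq : compl↓ n v ≡ compl↓ n w
    compl↓-eq = reverse-injective (trans (sym (compl-reverse n v)) (trans eq (compl-reverse n w)))

compl-surjective : Linked _<_ V → EntriesIn n V → ∃ λ v → ColumnIn n v × compl n v ≡ V
compl-surjective {V} {n} V↑ V∈ = compl↓ n (reverse V) , compl↓-column n (reverse V) , (begin
  compl n (compl↓ n (reverse V))             ≡⟨ compl-reverse n (compl↓ n (reverse V)) ⟩
  reverse (compl↓ n (compl↓ n (reverse V)))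
    ≡⟨ cong reverse (compl↓-involutive (Linked-reverse V↑ , All-reverse V∈)) ⟩
  reverse (reverse V)                        ≡⟨ reverse-involutive V ⟩
  V                                          ∎)
  where open ≡-Reasoning

-- Staircases and interleaving complements

-- Staircase v u unfolds to Interleaved _≤_ v u. For increasing lists,
-- Interleaved (flip _≤_) U V says U₀ ≤ V₀ ≤ U₁ ≤ V₁ ≤ … ≤ U_k.
Interleaved : (A → A → Set) → List A → List A → Set
Interleaved R xs ys = length xs ≡ suc (length ys) ×
  (∀ j a b c → xs ‼ suc j ≡ just a → ys ‼ j ≡ just b → xs ‼ j ≡ just c → R a b × R b c)

neighbours : ∀ {R : A → A → Set} {xs ys : List A} {b} j → Interleaved R xs ys → ys ‼ j ≡ just b →
             ∃₂ λ a c → xs ‼ j ≡ just a × xs ‼ suc j ≡ just c × R c b × R b a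
neighbours {xs = xs} {ys} j (len , between) eb
  with <⇒‼ xs (suc j) (subst (suc j <_) (sym len) (s≤s (‼⇒< ys j eb)))
... | c , ec with <⇒‼ xs j (<-trans (n<1+n j) (‼⇒< xs (suc j) ec))
... | a , ea = a , c , ea , ec , between j c _ a ec eb ea

Interleaved-reverse : ∀ {R : A → A → Set} {xs ys : List A} →
                      Interleaved R xs ys → Interleaved (flip R) (reverse xs) (reverse ys)
Interleaved-reverse {R = R} {xs} {ys} (len , between) = len′ , between′
  where
    L : ℕ
    L = length ys
    len′ : length (reverse xs) ≡ suc (length (reverse ys))
    len′ = trans (length-reverse xs) (trans len (cong suc (sym (length-reverse ys))))
    reverse-xs-‼ : ∀ k → k < suc L → reverse xs ‼ k ≡ xs ‼ (L ∸ k)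
    reverse-xs-‼ k k≤L = trans (reverse-‼ xs (subst (k <_) (sym len) k≤L)) (cong (λ l → xs ‼ (l ∸ suc k)) len)
    between′ : ∀ j a b c → reverse xs ‼ suc j ≡ just a → reverse ys ‼ j ≡ just b → reverse xs ‼ j ≡ just c →
               flip R a b × flip R b c
    between′ j a b c ea eb ec = swap (between (L ∸ suc j) c b a ec′ eb′ ea′)
      where
        j<L : j < L
        j<L = subst (j <_) (length-reverse ys) (‼⇒< (reverse ys) j eb)
        ea′ : xs ‼ (L ∸ suc j) ≡ just a
        ea′ = trans (sym (reverse-xs-‼ (suc j) (s≤s j<L))) ea
        eb′ : ys ‼ (L ∸ suc j) ≡ just b
        eb′ = trans (sym (reverse-‼ ys j<L)) eb
        ec′ : xs ‼ suc (L ∸ suc j) ≡ just c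
        ec′ = trans (cong (xs ‼_) (sym (+-∸-assoc 1 j<L))) (trans (sym (reverse-xs-‼ j (m≤n⇒m≤1+n j<L))) ec)

interleaved-entries : EntriesIn n U → Interleaved (flip _≤_) U V → EntriesIn n V
interleaved-entries {n = n} {U = U} {V = V} U∈ UV = ‼-All V λ j eV → bounds (neighbours {xs = U} {V} j UV eV)
  where
    bounds : ∀ {j b} → ∃₂ (λ a c → U ‼ j ≡ just a × U ‼ suc j ≡ just c × b ≤ c × a ≤ b) → 1 ≤ b × b ≤ n
    bounds {j} (_ , _ , eU , eU′ , b≤c , a≤b) =
      ≤-trans (proj₁ (All-‼ j U∈ eU)) a≤b , ≤-trans b≤c (proj₂ (All-‼ (suc j) U∈ eU′))

Zigzag : ℕ → List ℕ → List ℕ → Set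
Zigzag h []       []      = ⊤
Zigzag h []       (_ ∷ _) = ⊥
Zigzag h (x ∷ xs) ys      = x ≤ h × Zigzag x ys xs

Zigzag-mono : ∀ {h h′} → h ≤ h′ → Zigzag h xs ys → Zigzag h′ xs ys
Zigzag-mono {[]}    {[]}    _    _            = tt
Zigzag-mono {x ∷ _}         h≤h′ (x≤h , zig) = ≤-trans x≤h h≤h′ , zig

Zigzag-rebound : ∀ {h h′} → All (_≤ h′) xs → Zigzag h xs ys → Zigzag h′ xs ys
Zigzag-rebound {[]}    {[]} _           _         = tt
Zigzag-rebound {x ∷ _}      (x≤h′ ∷ _)  (_ , zig) = x≤h′ , zig

Zigzag-second-head : ∀ {h y} → All (_≤ m) xs → Zigzag h xs (y ∷ ys) → y ≤ m
Zigzag-second-head (x≤m ∷ _) (_ , y≤x , _) = ≤-trans y≤x x≤m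

staircase⇒zigzag : ∀ {h x} → x ≤ h → Staircase (x ∷ v) u → Zigzag h (x ∷ v) u
staircase⇒zigzag {[]}    {[]}    x≤h _       = x≤h , tt
staircase⇒zigzag {[]}    {_ ∷ _} _   (() , _)
staircase⇒zigzag {_ ∷ _} {[]}    _   (() , _)
staircase⇒zigzag {z ∷ v} {y ∷ u} {x = x} x≤h (len , between) with between 0 z y x refl refl refl
... | z≤y , y≤x = x≤h , y≤x , staircase⇒zigzag z≤y (suc-injective len , λ j → between (suc j))

zigzag⇒staircase : ∀ {h} → length v ≡ suc (length u) → Zigzag h v u → Staircase v u
zigzag⇒staircase {x ∷ []}    {[]}    _   _                 = refl , λ _ _ _ _ _ ()
zigzag⇒staircase {x ∷ z ∷ v} {y ∷ u} len (_ , y≤x , z≤y , zig)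
  with zigzag⇒staircase {z ∷ v} {u} (suc-injective len) (z≤y , zig)
... | len′ , between = cong suc len′ , λ where
  zero    _ _ _ refl refl refl → z≤y , y≤x
  (suc j) → between j

-- The value n + 1 cannot lie in ys alone; otherwise it is dropped from, or prepended to,
-- both complements.
Zigzag-compl↓ : ∀ n → ColumnIn n xs → ColumnIn n ys → Zigzag n xs ys →
                Zigzag n (compl↓ n ys) (compl↓ n xs)
Zigzag-compl↓ zero    _  _  _   = tt
Zigzag-compl↓ (suc n) cx cy zig with topView cx | topView cy
... | top {xs} cx′ | top {ys} cy′ rewrite compl↓-top n xs | compl↓-top n ys =
  Zigzag-mono (n≤1+n n) (Zigzag-compl↓ n cx′ cy′ (Zigzag-rebound (ColumnIn⇒≤ cx′) (proj₂ (proj₂ zig))))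
... | top {xs} cx′ | below cy′ rewrite compl↓-top n xs | compl↓-below cy′ =
  ≤-refl , Zigzag-mono (n≤1+n n) (Zigzag-compl↓ n cy′ cx′ (Zigzag-rebound (ColumnIn⇒≤ cy′) (proj₂ zig)))
... | below cx′ | top _ = ⊥-elim (1+n≰n (Zigzag-second-head (ColumnIn⇒≤ cx′) zig))
... | below cx′ | below cy′ rewrite compl↓-below cx′ | compl↓-below cy′ =
  ≤-refl , ≤-refl , Zigzag-mono (n≤1+n n) (Zigzag-compl↓ n cx′ cy′ (Zigzag-rebound (ColumnIn⇒≤ cx′) zig))

Staircase-compl↓ : ColumnIn n v → ColumnIn n u → Staircase v u → Staircase (compl↓ n u) (compl↓ n v)
Staircase-compl↓ {v = []} _ _ (() , _)
Staircase-compl↓ {n} {v@(_ ∷ _)} {u} cv cu st@(len , _) =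
  zigzag⇒staircase len′ (Zigzag-compl↓ n cv cu (staircase⇒zigzag (All.head (ColumnIn⇒≤ cv)) st))
  where
    open ≡-Reasoning
    len′ : length (compl↓ n u) ≡ suc (length (compl↓ n v))
    len′ = +-cancelʳ-≡ (length u) _ _ (begin
      length (compl↓ n u) + length u        ≡⟨ length-compl↓ cu ⟩
      n                                     ≡⟨ length-compl↓ cv ⟨
      length (compl↓ n v) + length v        ≡⟨ cong (length (compl↓ n v) +_) len ⟩
      length (compl↓ n v) + suc (length u)  ≡⟨ +-suc _ (length u) ⟩
      suc (length (compl↓ n v)) + length u  ∎)

staircase⇒compl-interleaved : ColumnIn n v → ColumnIn n u → Staircase v u →
                              Interleaved (flip _≤_) (compl n u) (compl n v)
staircase⇒compl-interleaved {n} {v} {u} cv cu st =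
  subst₂ (Interleaved (flip _≤_)) (sym (compl-reverse n u)) (sym (compl-reverse n v))
    (Interleaved-reverse {R = _≤_} {compl↓ n u} {compl↓ n v} (Staircase-compl↓ cv cu st))

compl-interleaved⇒staircase : ColumnIn n v → ColumnIn n u →
                              Interleaved (flip _≤_) (compl n u) (compl n v) → Staircase v u
compl-interleaved⇒staircase {n} {v} {u} cv cu UV =
  subst₂ Staircase (compl↓-involutive cv) (compl↓-involutive cu)
    (Staircase-compl↓ (compl↓-column n u) (compl↓-column n v) dual)
  where
    dual : Staircase (compl↓ n u) (compl↓ n v)
    dual = subst₂ (Interleaved _≤_) (reverse-involutive (compl↓ n u)) (reverse-involutive (compl↓ n v))
      (Interleaved-reverse {xs = reverse (compl↓ n u)} {reverse (compl↓ n v)}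
        (subst₂ (Interleaved (flip _≤_)) (compl-reverse n u) (compl-reverse n v) UV))

-- Shifted sequences

shiftUp : ℕ → List ℕ → List ℕ
shiftUp k []       = []
shiftUp k (x ∷ xs) = x + k ∷ shiftUp (suc k) xs

length-shiftDown : ∀ k xs → length (shiftDown k xs) ≡ length xs
length-shiftDown k []       = refl
length-shiftDown k (x ∷ xs) = cong suc (length-shiftDown (suc k) xs)

length-shiftUp : ∀ k xs → length (shiftUp k xs) ≡ length xs
length-shiftUp k []       = refl
length-shiftUp k (x ∷ xs) = cong suc (length-shiftUp (suc k) xs)

shiftDown-‼ : ∀ k xs i → shiftDown k xs ‼ i ≡ Maybe.map (_∸ (k + i)) (xs ‼ i)
shiftDown-‼ k []       i       = refl
shiftDown-‼ k (x ∷ xs) zero    rewrite +-identityʳ k = refl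
shiftDown-‼ k (x ∷ xs) (suc i) rewrite +-suc k i     = shiftDown-‼ (suc k) xs i

shiftUp-‼ : ∀ k xs i → shiftUp k xs ‼ i ≡ Maybe.map (_+ (k + i)) (xs ‼ i)
shiftUp-‼ k []       i       = refl
shiftUp-‼ k (x ∷ xs) zero    rewrite +-identityʳ k = refl
shiftUp-‼ k (x ∷ xs) (suc i) rewrite +-suc k i     = shiftUp-‼ (suc k) xs i

shiftDown-shiftUp : ∀ k xs → shiftDown k (shiftUp k xs) ≡ xs
shiftDown-shiftUp k []       = refl
shiftDown-shiftUp k (x ∷ xs) = cong₂ _∷_ (m+n∸n≡m x k) (shiftDown-shiftUp (suc k) xs)

Above : ℕ → List ℕ → Set
Above k []       = ⊤
Above k (x ∷ xs) = k ≤ x × Above (suc k) xs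

Above-‼ : ∀ {k} xs i → Above k xs → xs ‼ i ≡ just a → k + i ≤ a
Above-‼ {k = k} (x ∷ xs) zero    (k≤x , _) refl = subst (_≤ x) (sym (+-identityʳ k)) k≤x
Above-‼ {a = a} {k = k} (x ∷ xs) (suc i) (_ , above) e = subst (_≤ a) (sym (+-suc k i)) (Above-‼ xs i above e)

increasing⇒Above : ∀ {x} → Linked _<_ (x ∷ xs) → k ≤ x → Above k (x ∷ xs)
increasing⇒Above [-]       k≤x = k≤x , tt
increasing⇒Above (x<y ∷ l) k≤x = k≤x , increasing⇒Above l (≤-<-trans k≤x x<y)

compl-above : ∀ n w → Above 1 (compl n w)
compl-above n w with compl n w | compl-increasing n w | compl-entries n w
... | []    | _ | _              = tt
... | _ ∷ _ | U↑ | (1≤x , _) ∷ _ = increasing⇒Above U↑ 1≤x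

shiftUp-shiftDown : ∀ k xs → Above k xs → shiftUp k (shiftDown k xs) ≡ xs
shiftUp-shiftDown k []       _             = refl
shiftUp-shiftDown k (x ∷ xs) (k≤x , above) = cong₂ _∷_ (m∸n+n≡m k≤x) (shiftUp-shiftDown (suc k) xs above)

shiftDown-injective : ∀ k → Above k xs → Above k ys → shiftDown k xs ≡ shiftDown k ys → xs ≡ ys
shiftDown-injective {xs} {ys} k xs-above ys-above eq = begin
  xs                           ≡⟨ shiftUp-shiftDown k xs xs-above ⟨
  shiftUp k (shiftDown k xs)   ≡⟨ cong (shiftUp k) eq ⟩
  shiftUp k (shiftDown k ys)   ≡⟨ shiftUp-shiftDown k ys ys-above ⟩
  ys                           ∎
  where open ≡-Reasoning

shiftDown-weaklyIncr : ∀ k → Linked _<_ xs → WeaklyIncr (shiftDown k xs)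
shiftDown-weaklyIncr k []        = []
shiftDown-weaklyIncr k [-]       = [-]
shiftDown-weaklyIncr k (x<y ∷ l) = ∸-monoˡ-≤ (suc k) x<y ∷ shiftDown-weaklyIncr (suc k) l

shiftUp-increasing : ∀ k → WeaklyIncr xs → Linked _<_ (shiftUp k xs)
shiftUp-increasing k []        = []
shiftUp-increasing k [-]       = [-]
shiftUp-increasing k (x≤y ∷ l) = +-mono-≤-< x≤y (n<1+n k) ∷ shiftUp-increasing (suc k) l

-- Skew diagrams

¬InDiag : ∀ lam i {j p} → lam ‼ i ≡ just p → p < j → ¬ InDiag lam i j
¬InDiag _ _ e p<j (_ , e′ , _ , j≤a) with trans (sym e) e′
... | refl = <⇒≱ p<j j≤a

pad-weaklyIncr : WeaklyIncr μ → WeaklyIncr (pad μ)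
pad-weaklyIncr {[]}    _  = [-]
pad-weaklyIncr {_ ∷ _} μ↑ = z≤n ∷ μ↑

Contained⇒≤ : Contained μ ζ → μ ‼ j ≡ just m → ζ ‼ suc j ≡ just z → m ≤ z
Contained⇒≤ {m = zero} _ _ _ = z≤n
Contained⇒≤ {j = j} {m = suc m} μ⊆ζ eμ eζ with μ⊆ζ (suc j) (suc m) (suc m , eμ , s≤s z≤n , ≤-refl)
... | _ , eζ′ , _ , m<z with trans (sym eζ) eζ′
... | refl = m<z

≤⇒Contained : (∀ j {m} → μ ‼ j ≡ just m → ∃ λ z → ζ ‼ suc j ≡ just z × m ≤ z) → Contained μ ζ
≤⇒Contained _    zero    _ (_ , refl , s≤s _ , ())
≤⇒Contained rows (suc j) c (m , eμ , 1≤c , c≤m) with rows j eμ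
... | z , eζ , m≤z = z , eζ , 1≤c , ≤-trans c≤m m≤z

-- If ζ_j ≥ μ_j + 2, the columns μ_j + 1 and μ_j + 2 of rows j and j + 1 of ζ/μ form a
-- 2 × 2 square.
IsRibbon⇒≤ : WeaklyIncr ζ → WeaklyIncr μ → length ζ ≡ suc (length μ) → IsRibbon ζ μ →
             ζ ‼ j ≡ just z → μ ‼ j ≡ just m → z ≤ suc m
IsRibbon⇒≤ {ζ} {μ} {j} {z} {m} ζ↑ μ↑ len ribbon eζ eμ with z ≤? suc m
... | yes z≤1+m = z≤1+m
... | no  z≰1+m
  with <⇒‼ ζ (suc j) (subst (suc j <_) (sym len) (s≤s (‼⇒< μ j eμ)))
     | <⇒‼ (pad μ) j (s≤s (<⇒≤ (‼⇒< μ j eμ)))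
... | z′ , eζ′ | p , ep = ⊥-elim
  (ribbon j (suc m) (skew eζ ep p<1+m (<⇒≤ 2+m≤z) , skew eζ ep (m≤n⇒m≤1+n p<1+m) 2+m≤z ,
                     skew eζ′ eμ ≤-refl (<⇒≤ 2+m≤z′) , skew eζ′ eμ (n≤1+n (suc m)) 2+m≤z′))
  where
    2+m≤z : suc (suc m) ≤ z
    2+m≤z = ≰⇒> z≰1+m
    2+m≤z′ : suc (suc m) ≤ z′
    2+m≤z′ = ≤-trans 2+m≤z (Linked-‼ j ζ↑ eζ eζ′)
    p<1+m : p < suc m
    p<1+m = s≤s (Linked-‼ j (pad-weaklyIncr μ↑) ep eμ)
    skew : ∀ {i c z p} → ζ ‼ i ≡ just z → pad μ ‼ i ≡ just p → p < suc c → suc c ≤ z → InSkew ζ μ i (suc c)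
    skew {i} eζ ep p<c c≤z = (_ , eζ , s≤s z≤n , c≤z) , ¬InDiag (pad μ) i ep p<c

≤⇒IsRibbon : length ζ ≤ suc (length μ) → (∀ j {m} → μ ‼ j ≡ just m → ∃ λ z → ζ ‼ j ≡ just z × z ≤ suc m) →
             IsRibbon ζ μ
≤⇒IsRibbon {ζ} {μ} len rows i c (_ , ((_ , eζ , _ , c<z) , _) , ((_ , eζ′ , 1≤c , _) , c∉μ) , _)
  with <⇒‼ μ i (≤-pred (≤-trans (‼⇒< ζ (suc i) eζ′) len))
... | m , eμ with rows i eμ
... | z , eζ″ , z≤1+m with trans (sym eζ) eζ″
... | refl = c∉μ (m , eμ , 1≤c , ≤-pred (≤-trans c<z z≤1+m))

-- shape (compl n u) is the paper's ζ = 𝔭(u,n) + 1ᵏ.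
shape : List ℕ → List ℕ
shape U = map suc (shiftDown 1 U)

shape-‼ : ∀ U i → U ‼ i ≡ just a → shape U ‼ i ≡ just (suc (a ∸ suc i))
shape-‼ U i e = trans (map-‼ suc (shiftDown 1 U) i) (map-just (trans (shiftDown-‼ 1 U i) (map-just e)))

length-shape : ∀ U → length (shape U) ≡ length U
length-shape U = trans (length-map suc (shiftDown 1 U)) (length-shiftDown 1 U)

shape-weaklyIncr : Linked _<_ U → WeaklyIncr (shape U)
shape-weaklyIncr U↑ = Linked.map⁺ (Linked.map s≤s (shiftDown-weaklyIncr 1 U↑))

interleaved⇒Contained×IsRibbon : Above 1 U → Interleaved (flip _≤_) U V →
                                 Contained (shiftDown 1 V) (shape U) × IsRibbon (shape U) (shiftDown 1 V)
interleaved⇒Contained×IsRibbon {U} {V} U-above UV@(len , _) =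
  ≤⇒Contained {μ = shiftDown 1 V} {ζ = shape U} contained ,
  ≤⇒IsRibbon {ζ = shape U} {μ = shiftDown 1 V} (≤-reflexive lengths) ribbon
  where
    lengths : length (shape U) ≡ suc (length (shiftDown 1 V))
    lengths = trans (length-shape U) (trans len (cong suc (sym (length-shiftDown 1 V))))
    row : ∀ j {m} → shiftDown 1 V ‼ j ≡ just m → ∃ λ b → V ‼ j ≡ just b × b ∸ suc j ≡ m
    row j eμ = map-just⁻¹ (V ‼ j) (trans (sym (shiftDown-‼ 1 V j)) eμ)
    contained : ∀ j {m} → shiftDown 1 V ‼ j ≡ just m → ∃ λ z → shape U ‼ suc j ≡ just z × m ≤ z
    contained j eμ with row j eμ
    ... | b , eV , refl with neighbours {xs = U} {V} j UV eV
    ... | _ , _ , _ , eU′ , b≤c , _ =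
      _ , shape-‼ U (suc j) eU′ ,
      subst (b ∸ suc j ≤_) (+-∸-assoc 1 (Above-‼ U (suc j) U-above eU′)) (∸-monoˡ-≤ (suc j) b≤c)
    ribbon : ∀ j {m} → shiftDown 1 V ‼ j ≡ just m → ∃ λ z → shape U ‼ j ≡ just z × z ≤ suc m
    ribbon j eμ with row j eμ
    ... | b , eV , refl with neighbours {xs = U} {V} j UV eV
    ... | _ , _ , eU , _ , _ , a≤b = _ , shape-‼ U j eU , s≤s (∸-monoˡ-≤ (suc j) a≤b)

Contained×IsRibbon⇒interleaved : Above 1 U → Linked _<_ U → WeaklyIncr μ → length U ≡ suc (length μ) →
                                 Contained μ (shape U) → IsRibbon (shape U) μ →
                                 Interleaved (flip _≤_) U (shiftUp 1 μ)
Contained×IsRibbon⇒interleaved {U} {μ} U-above U↑ μ↑ len μ⊆ζ ribbon =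
  trans len (cong suc (sym (length-shiftUp 1 μ))) , between
  where
    between : ∀ j c b a → U ‼ suc j ≡ just c → shiftUp 1 μ ‼ j ≡ just b → U ‼ j ≡ just a → b ≤ c × a ≤ b
    between j c b a eU′ eV eU with map-just⁻¹ (μ ‼ j) (trans (sym (shiftUp-‼ 1 μ j)) eV)
    ... | m , eμ , refl = m+1+j≤c , a≤m+1+j
      where
        2+j≤c : suc (suc j) ≤ c
        2+j≤c = Above-‼ U (suc j) U-above eU′
        m≤c∸1+j : m ≤ c ∸ suc j
        m≤c∸1+j = subst (m ≤_) (sym (+-∸-assoc 1 2+j≤c))
                    (Contained⇒≤ {μ = μ} {ζ = shape U} μ⊆ζ eμ (shape-‼ U (suc j) eU′))
        m+1+j≤c : m + suc j ≤ c
        m+1+j≤c = m≤o∸n⇒m+n≤o m (<⇒≤ 2+j≤c) m≤c∸1+j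
        a∸1+j≤m : a ∸ suc j ≤ m
        a∸1+j≤m = ≤-pred (IsRibbon⇒≤ (shape-weaklyIncr U↑) μ↑ (trans (length-shape U) len) ribbon
                                     (shape-‼ U j eU) eμ)
        a≤m+1+j : a ≤ m + suc j
        a≤m+1+j = subst (_≤ m + suc j) (m∸n+n≡m (Above-‼ U j U-above eU)) (+-monoˡ-≤ (suc j) a∸1+j≤m)

Source⇒ColumnIn : Source n u v → ColumnIn n v
Source⇒ColumnIn ((v↓ , _) , v∈ , _) = v↓ , v∈

ColumnIn⇒Source : ColumnIn n v → Staircase v u → Source n u v
ColumnIn⇒Source (v↓ , v∈) st = (v↓ , All.map proj₁ v∈) , v∈ , st

𝔭-target : ColumnIn n u → Source n u v → Target n u (𝔭 v n)
𝔭-target {n} {u} {v} cu sv@(_ , _ , st) =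
  length-𝔭 , shiftDown-weaklyIncr 1 (compl-increasing n v) , interleaved⇒Contained×IsRibbon (compl-above n u) UV
  where
    UV : Interleaved (flip _≤_) (compl n u) (compl n v)
    UV = staircase⇒compl-interleaved (Source⇒ColumnIn {u = u} sv) cu st
    length-𝔭 : length (𝔭 v n) ≡ n ∸ length u ∸ 1
    length-𝔭 = begin
      length (𝔭 v n)             ≡⟨ length-shiftDown 1 (compl n v) ⟩
      length (compl n v)         ≡⟨ cong pred (proj₁ UV) ⟨
      pred (length (compl n u))  ≡⟨ cong pred (length-compl cu) ⟩
      pred (n ∸ length u)        ∎
      where open ≡-Reasoning

𝔭-injective : ColumnIn n v → ColumnIn n w → 𝔭 v n ≡ 𝔭 w n → v ≡ w
𝔭-injective {n} {v} {w} cv cw =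
  compl-injective cv cw ∘ shiftDown-injective 1 (compl-above n v) (compl-above n w)

target⇒interleaved : ColumnIn n u → length u < n → Target n u μ →
                     Interleaved (flip _≤_) (compl n u) (shiftUp 1 μ)
target⇒interleaved {n} {u} {μ} cu |u|<n (|μ| , μ↑ , μ⊆ζ , ribbon) =
  Contained×IsRibbon⇒interleaved (compl-above n u) (compl-increasing n u) μ↑ |U| μ⊆ζ ribbon
  where
    |U| : length (compl n u) ≡ suc (length μ)
    |U| = begin
      length (compl n u)        ≡⟨ length-compl cu ⟩
      n ∸ length u              ≡⟨ suc-pred (n ∸ length u) {{>-nonZero (m<n⇒0<n∸m |u|<n)}} ⟨
      suc (n ∸ length u ∸ 1)    ≡⟨ cong suc |μ| ⟨
      suc (length μ)            ∎
      where open ≡-Reasoning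

𝔭-surjective : ColumnIn n u → length u < n → Target n u μ → ∃ λ v → Source n u v × 𝔭 v n ≡ μ
𝔭-surjective {n} {u} {μ} cu |u|<n target@(_ , μ↑ , _)
  with target⇒interleaved cu |u|<n target
... | UV with compl-surjective (shiftUp-increasing 1 μ↑) (interleaved-entries (compl-entries n u) UV)
... | v , cv , compl-v≡V =
  v , ColumnIn⇒Source {u = u} cv (compl-interleaved⇒staircase cv cu UV′) ,
  trans (cong (shiftDown 1) compl-v≡V) (shiftDown-shiftUp 1 μ)
  where
    UV′ : Interleaved (flip _≤_) (compl n u) (compl n v)
    UV′ = subst (Interleaved (flip _≤_) (compl n u)) (sym compl-v≡V) UV

lemma3p1 : (n : ℕ) → 1 ≤ n → (u : List ℕ) → IsColumn u → EntriesIn n u →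
    length u < n →
    ((v : List ℕ) → Source n u v → Target n u (𝔭 v n)) ×
    ((v w : List ℕ) → Source n u v → Source n u w → 𝔭 v n ≡ 𝔭 w n → v ≡ w) ×
    ((μ : List ℕ) → Target n u μ → Σ (List ℕ) (λ v → Source n u v × 𝔭 v n ≡ μ))
-- The hypothesis 1 ≤ n is implied by length u < n.
lemma3p1 n _ u (u↓ , _) u∈ |u|<n =
  (λ _ → 𝔭-target cu) ,
  (λ _ _ sv sw → 𝔭-injective (Source⇒ColumnIn {u = u} sv) (Source⇒ColumnIn {u = u} sw)) ,
  (λ _ → 𝔭-surjective cu |u|<n)
  where
    cu : ColumnIn n u
    cu = u↓ , u∈
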